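{- The rule $(lwr)$: from $\mathcal{G}/\!/\Gamma_1\vdash A,\Delta_1/\!/\Gamma_2\vdash\Delta_2/\!/\mathcal{H}$ infer $\mathcal{G}/\!/\Gamma_1\vdash\Delta_1/\!/\Gamma_2\vdash A,\Delta_2/\!/\mathcal{H}$, is height-preserving admissible in $\mathsf{LNIF}$: whenever the premise has an $\mathsf{LNIF}$-derivation of height $h$, the conclusion has an $\mathsf{LNIF}$-derivation of height at most $h$.
   Context: The height of a derivation is the number of sequents on its longest branch from the end sequent to an initial sequent. Formulae are first-order over $\bot,\land,\lor,\supset,\forall,\exists$; in sequents bound variables $x,y,\dots$ are distinct from parameters $a,b,\dots$, which occupy all free positions; $A[a/x]$ replaces free occurrences of $x$ by $a$; $p(\vec a)$ is an atomic formula with parameters $\vec a$. A linear nested sequent is $\Gamma_1\vdash\Delta_1 /\!/ \cdots /\!/ \Gamma_n\vdash\Delta_n$ ($n\ge1$), each $\Gamma_i,\Delta_i$ a finite, possibly empty, multiset of formulae (a component). In rule schemas, $\mathcal{G},\mathcal{H},\mathcal{F}$ denote possibly empty sequences of components. $\mathsf{LNIF}$ has the rules (from premise(s) infer conclusion): Initial: $(id_1)$ $\mathcal{G}/\!/\Gamma,p(\vec a)\vdash p(\vec a),\Delta/\!/\mathcal{H}$; $(id_2)$ $\mathcal{G}/\!/\Gamma_1,p(\vec a)\vdash\Delta_1/\!/\mathcal{H}/\!/\Gamma_2\vdash p(\vec a),\Delta_2/\!/\mathcal{F}$; $(\bot_l)$ $\mathcal{G}/\!/\Gamma,\bot\vdash\Delta/\!/\mathcal{H}$.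 $(\land_l)$: from $\mathcal{G}/\!/\Gamma,A,B\vdash\Delta/\!/\mathcal{H}$ infer $\mathcal{G}/\!/\Gamma,A\land B\vdash\Delta/\!/\mathcal{H}$. $(\lor_r)$: from $\mathcal{G}/\!/\Gamma\vdash\Delta,A,B/\!/\mathcal{H}$ infer $\mathcal{G}/\!/\Gamma\vdash\Delta,A\lor B/\!/\mathcal{H}$. $(\land_r)$: from $\mathcal{G}/\!/\Gamma\vdash\Delta,A/\!/\mathcal{H}$ and $\mathcal{G}/\!/\Gamma\vdash\Delta,B/\!/\mathcal{H}$ infer $\mathcal{G}/\!/\Gamma\vdash\Delta,A\land B/\!/\mathcal{H}$. $(\lor_l)$: from $\mathcal{G}/\!/\Gamma,A\vdash\Delta/\!/\mathcal{H}$ and $\mathcal{G}/\!/\Gamma,B\vdash\Delta/\!/\mathcal{H}$ infer $\mathcal{G}/\!/\Gamma,A\lor B\vdash\Delta/\!/\mathcal{H}$. $(\supset_{r1})$: from $\mathcal{G}/\!/\Gamma\vdash\Delta/\!/A\vdash B$ infer $\mathcal{G}/\!/\Gamma\vdash\Delta,A\supset B$. $(\supset_l)$: from $\mathcal{G}/\!/\Gamma,B\vdash\Delta/\!/\mathcal{H}$ and $\mathcal{G}/\!/\Gamma,A\supset B\vdash A,\Delta/\!/\mathcal{H}$ infer $\mathcal{G}/\!/\Gamma,A\supset B\vdash\Delta/\!/\mathcal{H}$. $(lift)$: from $\mathcal{G}/\!/\Gamma_1,A\vdash\Delta_1/\!/\Gamma_2,A\vdash\Delta_2/\!/\mathcal{H}$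 infer $\mathcal{G}/\!/\Gamma_1,A\vdash\Delta_1/\!/\Gamma_2\vdash\Delta_2/\!/\mathcal{H}$. $(\forall_l)$: from $\mathcal{G}/\!/\Gamma,A[a/x],\forall xA\vdash\Delta/\!/\mathcal{H}$ infer $\mathcal{G}/\!/\Gamma,\forall xA\vdash\Delta/\!/\mathcal{H}$ ($a$ any parameter). $(\forall_{r1})$: from $\mathcal{G}/\!/\Gamma\vdash\Delta/\!/\ \vdash A[a/x]$ infer $\mathcal{G}/\!/\Gamma\vdash\Delta,\forall xA$. $(\exists_l)$: from $\mathcal{G}/\!/\Gamma,A[a/x]\vdash\Delta/\!/\mathcal{H}$ infer $\mathcal{G}/\!/\Gamma,\exists xA\vdash\Delta/\!/\mathcal{H}$. $(\exists_r)$: from $\mathcal{G}/\!/\Gamma\vdash A[a/x],\exists xA,\Delta/\!/\mathcal{H}$ infer $\mathcal{G}/\!/\Gamma\vdash\exists xA,\Delta/\!/\mathcal{H}$ ($a$ any parameter). $(\supset_{r2})$: from $\mathcal{G}/\!/\Gamma_1\vdash\Delta_1/\!/A\vdash B/\!/\Gamma_2\vdash\Delta_2/\!/\mathcal{H}$ and $\mathcal{G}/\!/\Gamma_1\vdash\Delta_1/\!/\Gamma_2\vdash\Delta_2,A\supset B/\!/\mathcal{H}$ infer $\mathcal{G}/\!/\Gamma_1\vdash\Delta_1,A\supset B/\!/\Gamma_2\vdash\Delta_2/\!/\mathcal{H}$. $(\forall_{r2})$: from $\mathcal{G}/\!/\Gamma_1\vdash\Delta_1/\!/\ \vdash A[a/x]/\!/\Gamma_2\vdash\Delta_2/\!/\mathcal{H}$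 and $\mathcal{G}/\!/\Gamma_1\vdash\Delta_1/\!/\Gamma_2\vdash\Delta_2,\forall xA/\!/\mathcal{H}$ infer $\mathcal{G}/\!/\Gamma_1\vdash\Delta_1,\forall xA/\!/\Gamma_2\vdash\Delta_2/\!/\mathcal{H}$. In $(\forall_{r1}),(\exists_l),(\forall_{r2})$, $a$ is an eigenvariable (does not occur in the conclusion). -}

module Defs where

open import Data.Nat using (ℕ; suc; _≡ᵇ_)
open import Data.Bool using (if_then_else_)
open import Data.List using (List; []; _∷_; _++_; [_]; concatMap)
open import Data.List.Membership.Propositional using (_∉_)
open import Data.List.Relation.Binary.Permutation.Propositional using (_↭_)
open import Data.List.Relation.Binary.Pointwise using (Pointwise)
open import Data.Product using (_×_)

data Term : Set where
  var : ℕ → Term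
  par : ℕ → Term

infixr 8 _∧'_
infixr 7 _∨'_
infixr 6 _⊃_

data Formula : Set where
  atom  : ℕ → List Term → Formula
  ⊥'    : Formula
  _∧'_  : Formula → Formula → Formula
  _∨'_  : Formula → Formula → Formula
  _⊃_   : Formula → Formula → Formula
  ∀'    : ℕ → Formula → Formula
  ∃'    : ℕ → Formula → Formula

substT : Term → ℕ → ℕ → Term
substT (var y) a x = if y ≡ᵇ x then par a else var y
substT (par b) a x = par b

substTs : List Term → ℕ → ℕ → List Term
substTs []       a x = []
substTs (t ∷ ts) a x = substT t a x ∷ substTs ts a x

_[_/_] : Formula → ℕ → ℕ → Formula
atom P ts [ a / x ] = atom P (substTs ts a x)
⊥'        [ a / x ] = ⊥'
(A ∧' B)  [ a / x ] = (A [ a / x ]) ∧' (B [ a / x ])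
(A ∨' B)  [ a / x ] = (A [ a / x ]) ∨' (B [ a / x ])
(A ⊃ B)   [ a / x ] = (A [ a / x ]) ⊃ (B [ a / x ])
∀' y A    [ a / x ] = if y ≡ᵇ x then ∀' y A else ∀' y (A [ a / x ])
∃' y A    [ a / x ] = if y ≡ᵇ x then ∃' y A else ∃' y (A [ a / x ])

parsT : List Term → List ℕ
parsT []            = []
parsT (var _ ∷ ts)  = parsT ts
parsT (par a ∷ ts)  = a ∷ parsT ts

parsF : Formula → List ℕ
parsF (atom P ts) = parsT ts
parsF ⊥'          = []
parsF (A ∧' B)    = parsF A ++ parsF B
parsF (A ∨' B)    = parsF A ++ parsF B
parsF (A ⊃ B)     = parsF A ++ parsF B
parsF (∀' x A)    = parsF A
parsF (∃' x A)    = parsF A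

-- Linear nested sequents.  A component Γ ⊢ Δ has multisets Γ, Δ,
-- represented as lists taken up to permutation (_↭_).

infix 3 _⊢_
record Comp : Set where
  constructor _⊢_
  field
    ante : List Formula
    succ : List Formula
open Comp public

LNS : Set
LNS = List Comp

_≈C_ : Comp → Comp → Set
c ≈C d = (ante c ↭ ante d) × (succ c ↭ succ d)

_≈_ : LNS → LNS → Set
_≈_ = Pointwise _≈C_

parsL : List Formula → List ℕ
parsL = concatMap parsF

parsS : LNS → List ℕ
parsS = concatMap (λ c → parsL (ante c) ++ parsL (succ c))

-- Der h S : S has an LNIF-derivation of height ≤ h
-- (height = number of sequents on the longest branch).  Each rule's
-- conclusion S is required to equal (as multisets, via _≈_) the
-- conclusion schema.

data Der : ℕ → LNS → Set where
  id₁ : ∀ {h S} G H Γ Δ P ts →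
        S ≈ (G ++ (atom P ts ∷ Γ ⊢ atom P ts ∷ Δ) ∷ H) →
        Der (suc h) S
  id₂ : ∀ {h S} G H F Γ₁ Δ₁ Γ₂ Δ₂ P ts →
        S ≈ (G ++ (atom P ts ∷ Γ₁ ⊢ Δ₁) ∷ H ++ (Γ₂ ⊢ atom P ts ∷ Δ₂) ∷ F) →
        Der (suc h) S
  ⊥l  : ∀ {h S} G H Γ Δ →
        S ≈ (G ++ (⊥' ∷ Γ ⊢ Δ) ∷ H) →
        Der (suc h) S
  ∧l  : ∀ {h S} G H Γ Δ A B →
        S ≈ (G ++ (A ∧' B ∷ Γ ⊢ Δ) ∷ H) →
        Der h (G ++ (A ∷ B ∷ Γ ⊢ Δ) ∷ H) →
        Der (suc h) S
  ∨r  : ∀ {h S} G H Γ Δ A B →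
        S ≈ (G ++ (Γ ⊢ A ∨' B ∷ Δ) ∷ H) →
        Der h (G ++ (Γ ⊢ A ∷ B ∷ Δ) ∷ H) →
        Der (suc h) S
  ∧r  : ∀ {h S} G H Γ Δ A B →
        S ≈ (G ++ (Γ ⊢ A ∧' B ∷ Δ) ∷ H) →
        Der h (G ++ (Γ ⊢ A ∷ Δ) ∷ H) →
        Der h (G ++ (Γ ⊢ B ∷ Δ) ∷ H) →
        Der (suc h) S
  ∨l  : ∀ {h S} G H Γ Δ A B →
        S ≈ (G ++ (A ∨' B ∷ Γ ⊢ Δ) ∷ H) →
        Der h (G ++ (A ∷ Γ ⊢ Δ) ∷ H) →
        Der h (G ++ (B ∷ Γ ⊢ Δ) ∷ H) →
        Der (suc h) S
  ⊃r₁ : ∀ {h S} G Γ Δ A B →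
        S ≈ (G ++ [ Γ ⊢ A ⊃ B ∷ Δ ]) →
        Der h (G ++ (Γ ⊢ Δ) ∷ [ [ A ] ⊢ [ B ] ]) →
        Der (suc h) S
  ⊃l  : ∀ {h S} G H Γ Δ A B →
        S ≈ (G ++ (A ⊃ B ∷ Γ ⊢ Δ) ∷ H) →
        Der h (G ++ (B ∷ Γ ⊢ Δ) ∷ H) →
        Der h (G ++ (A ⊃ B ∷ Γ ⊢ A ∷ Δ) ∷ H) →
        Der (suc h) S
  lift : ∀ {h S} G H Γ₁ Δ₁ Γ₂ Δ₂ A →
        S ≈ (G ++ (A ∷ Γ₁ ⊢ Δ₁) ∷ (Γ₂ ⊢ Δ₂) ∷ H) →
        Der h (G ++ (A ∷ Γ₁ ⊢ Δ₁) ∷ (A ∷ Γ₂ ⊢ Δ₂) ∷ H) →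
        Der (suc h) S
  ∀l  : ∀ {h S} G H Γ Δ x A a →
        S ≈ (G ++ (∀' x A ∷ Γ ⊢ Δ) ∷ H) →
        Der h (G ++ (A [ a / x ] ∷ ∀' x A ∷ Γ ⊢ Δ) ∷ H) →
        Der (suc h) S
  ∀r₁ : ∀ {h S} G Γ Δ x A a →
        S ≈ (G ++ [ Γ ⊢ ∀' x A ∷ Δ ]) →
        a ∉ parsS S →
        Der h (G ++ (Γ ⊢ Δ) ∷ [ [] ⊢ [ A [ a / x ] ] ]) →
        Der (suc h) S
  ∃l  : ∀ {h S} G H Γ Δ x A a →
        S ≈ (G ++ (∃' x A ∷ Γ ⊢ Δ) ∷ H) →
        a ∉ parsS S →
        Der h (G ++ (A [ a / x ] ∷ Γ ⊢ Δ) ∷ H) →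
        Der (suc h) S
  ∃r  : ∀ {h S} G H Γ Δ x A a →
        S ≈ (G ++ (Γ ⊢ ∃' x A ∷ Δ) ∷ H) →
        Der h (G ++ (Γ ⊢ A [ a / x ] ∷ ∃' x A ∷ Δ) ∷ H) →
        Der (suc h) S
  ⊃r₂ : ∀ {h S} G H Γ₁ Δ₁ Γ₂ Δ₂ A B →
        S ≈ (G ++ (Γ₁ ⊢ A ⊃ B ∷ Δ₁) ∷ (Γ₂ ⊢ Δ₂) ∷ H) →
        Der h (G ++ (Γ₁ ⊢ Δ₁) ∷ ([ A ] ⊢ [ B ]) ∷ (Γ₂ ⊢ Δ₂) ∷ H) →
        Der h (G ++ (Γ₁ ⊢ Δ₁) ∷ (Γ₂ ⊢ A ⊃ B ∷ Δ₂) ∷ H) →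
        Der (suc h) S
  ∀r₂ : ∀ {h S} G H Γ₁ Δ₁ Γ₂ Δ₂ x A a →
        S ≈ (G ++ (Γ₁ ⊢ ∀' x A ∷ Δ₁) ∷ (Γ₂ ⊢ Δ₂) ∷ H) →
        a ∉ parsS S →
        Der h (G ++ (Γ₁ ⊢ Δ₁) ∷ ([] ⊢ [ A [ a / x ] ]) ∷ (Γ₂ ⊢ Δ₂) ∷ H) →
        Der h (G ++ (Γ₁ ⊢ Δ₁) ∷ (Γ₂ ⊢ ∀' x A ∷ Δ₂) ∷ H) →
        Der (suc h) S

-- By induction on the height, one move of a succedent formula A from a component
-- to the next one commutes with the last rule of a derivation.  If A lies in the
-- context of the rule, the rule is re-applied to the moved premises (for ⊃r₂ and
-- ∀r₂, A crosses the inserted component in two moves).  If A is principal in a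
-- right rule, that rule is re-applied one component later to premises whose
-- active formulas have been moved along; for ⊃r₂ and ∀r₂ the result is literally
-- the second premise.  Initial sequents stay initial, since an atom on the right
-- only moves further right.  Multiset bookkeeping and eigenvariable conditions are
-- unaffected, because a move does not change the multiset of formulas of a sequent.
module Submission where

open import Defs
open import Data.Nat using (ℕ; zero; suc)
open import Data.List using (List; []; _∷_; _++_; [_]; concatMap; map)
open import Data.List.Properties using (++-assoc; concatMap-++)
open import Data.List.Relation.Binary.Pointwise as Pointwise using ([]; _∷_)
open import Data.List.Relation.Binary.Permutation.Propositional
  using (_↭_; ↭-refl; ↭-sym; ↭-trans; ↭-prep; ↭-swap; module PermutationReasoning)
open import Data.List.Relation.Binary.Permutation.Propositional.Properties
  using (∈-resp-↭; shift; drop-∷; ++⁺ˡ; ++⁺ʳ; ++⁺)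
open import Data.List.Relation.Binary.Subset.Propositional.Properties using (⊆-reflexive-↭; concatMap⁺)
open import Data.List.Membership.Propositional using (_∈_; _∉_; find)
open import Data.List.Membership.Propositional.Properties using (∈-∃++; ∈-++⁻)
open import Data.List.Relation.Unary.Any using (Any; here; there)
import Data.List.Relation.Unary.Any.Properties as Any
open import Data.List.Relation.Unary.All as All using (All; []; _∷_)
import Data.List.Relation.Unary.All.Properties as All
open import Data.Product using (∃-syntax; _×_; _,_)
open import Data.Sum using (_⊎_; inj₁; inj₂)
open import Data.Unit using (⊤; tt)
open import Function using (const)
open import Relation.Binary.PropositionalEquality using (_≡_; refl; sym; cong₂; subst; module ≡-Reasoning)

∷↭++∷ : ∀ {A : Formula} xs {ys} → A ∷ xs ++ ys ↭ xs ++ A ∷ ys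
∷↭++∷ xs = ↭-sym (shift _ xs _)

∷-swap : ∀ {A B : Formula} {Δ} → A ∷ B ∷ Δ ↭ B ∷ A ∷ Δ
∷-swap = ↭-swap _ _ ↭-refl

∈⇒↭ : ∀ {A : Formula} {xs} → A ∈ xs → ∃[ ys ] xs ↭ A ∷ ys
∈⇒↭ A∈xs with us , vs , refl ← ∈-∃++ A∈xs = us ++ vs , shift _ us vs

↭-∷-split : ∀ {A : Formula} xs ys {zs} → xs ++ ys ↭ A ∷ zs →
            A ∈ xs ⊎ ∃[ ys₀ ] ys ↭ A ∷ ys₀ × zs ↭ xs ++ ys₀
↭-∷-split xs ys p with ∈-++⁻ xs (∈-resp-↭ (↭-sym p) (here refl))
... | inj₁ A∈xs = inj₁ A∈xs
... | inj₂ A∈ys with ys₀ , q ← ∈⇒↭ A∈ys =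
  inj₂ (ys₀ , q , drop-∷ (↭-trans (↭-sym p) (↭-trans (++⁺ˡ xs q) (shift _ xs ys₀))))

≈C-refl : ∀ {c} → c ≈C c
≈C-refl = ↭-refl , ↭-refl

≈C-sym : ∀ {c d} → c ≈C d → d ≈C c
≈C-sym (p , q) = ↭-sym p , ↭-sym q

≈C-trans : ∀ {c d e} → c ≈C d → d ≈C e → c ≈C e
≈C-trans (p , q) (p′ , q′) = ↭-trans p p′ , ↭-trans q q′

≈-refl : ∀ {S} → S ≈ S
≈-refl = Pointwise.refl ≈C-refl

≈-sym : ∀ {S T} → S ≈ T → T ≈ S
≈-sym = Pointwise.symmetric ≈C-sym

≈-trans : ∀ {S T U} → S ≈ T → T ≈ U → S ≈ U
≈-trans = Pointwise.transitive ≈C-trans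

≈-++ˡ : ∀ G {S T} → S ≈ T → (G ++ S) ≈ (G ++ T)
≈-++ˡ = Pointwise.++⁺ˡ ≈C-refl

≈-at : ∀ G {c d H} → c ≈C d → (G ++ c ∷ H) ≈ (G ++ d ∷ H)
≈-at G c≈d = ≈-++ˡ G (c≈d ∷ ≈-refl)

≈-assocʳ : ∀ G {c c′ d d′ H} → c ≈C c′ → d ≈C d′ → (G ++ c ∷ d ∷ H) ≈ ((G ++ [ c′ ]) ++ d′ ∷ H)
≈-assocʳ []      c≈ d≈ = c≈ ∷ d≈ ∷ ≈-refl
≈-assocʳ (_ ∷ G) c≈ d≈ = ≈C-refl ∷ ≈-assocʳ G c≈ d≈

formulas : LNS → List Formula
formulas = concatMap (λ c → ante c ++ succ c)

SameFormulas : LNS → LNS → Set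
SameFormulas S T = formulas S ↭ formulas T

parsS≡parsL-formulas : ∀ S → parsS S ≡ parsL (formulas S)
parsS≡parsL-formulas []            = refl
parsS≡parsL-formulas ((Γ ⊢ Δ) ∷ S) = begin
  (parsL Γ ++ parsL Δ) ++ parsS S       ≡⟨ cong₂ _++_ (sym (concatMap-++ parsF Γ Δ)) (parsS≡parsL-formulas S) ⟩
  parsL (Γ ++ Δ) ++ parsL (formulas S)  ≡⟨ sym (concatMap-++ parsF (Γ ++ Δ) (formulas S)) ⟩
  parsL ((Γ ++ Δ) ++ formulas S)        ∎
  where open ≡-Reasoning

∉parsS-resp : ∀ {a S T} → SameFormulas S T → a ∉ parsS S → a ∉ parsS T
∉parsS-resp {a} {S} {T} S~T a∉S a∈T = a∉S (subst (a ∈_) (sym (parsS≡parsL-formulas S))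
  (concatMap⁺ parsF (⊆-reflexive-↭ (↭-sym S~T)) (subst (a ∈_) (parsS≡parsL-formulas T) a∈T)))

≈⇒SameFormulas : ∀ {S T} → S ≈ T → SameFormulas S T
≈⇒SameFormulas []              = ↭-refl
≈⇒SameFormulas ((p , q) ∷ S≈T) = ++⁺ (++⁺ p q) (≈⇒SameFormulas S≈T)

infix 4 _⇝_
data _⇝_ : LNS → LNS → Set where
  ⇝-here  : ∀ {Γ₁ Δ₁ Δ₁′ Γ₂ Δ₂ H} A → Δ₁ ↭ A ∷ Δ₁′ →
            (Γ₁ ⊢ Δ₁) ∷ (Γ₂ ⊢ Δ₂) ∷ H ⇝ (Γ₁ ⊢ Δ₁′) ∷ (Γ₂ ⊢ A ∷ Δ₂) ∷ H
  ⇝-there : ∀ {c S T} → S ⇝ T → c ∷ S ⇝ c ∷ T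

⇝-++ˡ : ∀ G {S T} → S ⇝ T → G ++ S ⇝ G ++ T
⇝-++ˡ []      m = m
⇝-++ˡ (_ ∷ G) m = ⇝-there (⇝-++ˡ G m)

⇝-++ʳ : ∀ {S T} K → S ⇝ T → S ++ K ⇝ T ++ K
⇝-++ʳ K (⇝-here A p) = ⇝-here A p
⇝-++ʳ K (⇝-there m)  = ⇝-there (⇝-++ʳ K m)

⇝-at : ∀ G {Γ₁ Δ₁ Δ₁′ Γ₂ Δ₂ H} A → Δ₁ ↭ A ∷ Δ₁′ →
       G ++ (Γ₁ ⊢ Δ₁) ∷ (Γ₂ ⊢ Δ₂) ∷ H ⇝ G ++ (Γ₁ ⊢ Δ₁′) ∷ (Γ₂ ⊢ A ∷ Δ₂) ∷ H
⇝-at G A p = ⇝-++ˡ G (⇝-here A p)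

⇝-at-snoc : ∀ G {Γ₁ Δ₁ Δ₁′ Γ₂ Δ₂ H} A → Δ₁ ↭ A ∷ Δ₁′ →
            (G ++ [ Γ₁ ⊢ Δ₁ ]) ++ (Γ₂ ⊢ Δ₂) ∷ H ⇝ (G ++ [ Γ₁ ⊢ Δ₁′ ]) ++ (Γ₂ ⊢ A ∷ Δ₂) ∷ H
⇝-at-snoc []      A p = ⇝-here A p
⇝-at-snoc (_ ∷ G) A p = ⇝-there (⇝-at-snoc G A p)

⇝-resp-≈ : ∀ {S S′ T} → S ≈ S′ → S ⇝ T → ∃[ T′ ] S′ ⇝ T′ × T ≈ T′
⇝-resp-≈ ((Γ₁≈ , Δ₁≈) ∷ (Γ₂≈ , Δ₂≈) ∷ H≈) (⇝-here A p) =
  _ , ⇝-here A (↭-trans (↭-sym Δ₁≈) p) , (Γ₁≈ , ↭-refl) ∷ (Γ₂≈ , ↭-prep A Δ₂≈) ∷ H≈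
⇝-resp-≈ (c≈ ∷ S≈) (⇝-there m) with _ , m′ , T≈ ← ⇝-resp-≈ S≈ m = _ , ⇝-there m′ , c≈ ∷ T≈

⇝⇒SameFormulas : ∀ {S T} → S ⇝ T → SameFormulas S T
⇝⇒SameFormulas (⇝-there {c} m) = ++⁺ˡ (ante c ++ succ c) (⇝⇒SameFormulas m)
⇝⇒SameFormulas (⇝-here {Γ₁} {Δ₁} {Δ₁′} {Γ₂} {Δ₂} {H} A p) = begin
  (Γ₁ ++ Δ₁) ++ (Γ₂ ++ Δ₂) ++ formulas H       ↭⟨ ++⁺ʳ _ (↭-trans (++⁺ˡ Γ₁ p) (shift A Γ₁ Δ₁′)) ⟩
  A ∷ (Γ₁ ++ Δ₁′) ++ (Γ₂ ++ Δ₂) ++ formulas H  ↭⟨ ∷↭++∷ (Γ₁ ++ Δ₁′) ⟩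
  (Γ₁ ++ Δ₁′) ++ A ∷ (Γ₂ ++ Δ₂) ++ formulas H  ↭⟨ ++⁺ˡ (Γ₁ ++ Δ₁′) (++⁺ʳ (formulas H) (∷↭++∷ Γ₂)) ⟩
  (Γ₁ ++ Δ₁′) ++ (Γ₂ ++ A ∷ Δ₂) ++ formulas H  ∎
  where open PermutationReasoning

∉parsS-resp-≈ : ∀ {a S T} → S ≈ T → a ∉ parsS S → a ∉ parsS T
∉parsS-resp-≈ {S = S} {T} S≈T = ∉parsS-resp {S = S} {T} (≈⇒SameFormulas S≈T)

∉parsS-resp-⇝ : ∀ {a S T} → S ⇝ T → a ∉ parsS S → a ∉ parsS T
∉parsS-resp-⇝ {S = S} {T} m = ∉parsS-resp {S = S} {T} (⇝⇒SameFormulas m)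

data Located : LNS → Comp → LNS → LNS → Set where
  before : ∀ {G G′ c H} → G ⇝ G′ → Located G c H (G′ ++ c ∷ H)
  into   : ∀ G₀ {Γ₀ Δ₀ Δ₀′ c H} A → Δ₀ ↭ A ∷ Δ₀′ →
           Located (G₀ ++ [ Γ₀ ⊢ Δ₀ ]) c H (G₀ ++ (Γ₀ ⊢ Δ₀′) ∷ (ante c ⊢ A ∷ succ c) ∷ H)
  outof  : ∀ {G c Δ′ Γ₂ Δ₂ H} A → succ c ↭ A ∷ Δ′ →
           Located G c ((Γ₂ ⊢ Δ₂) ∷ H) (G ++ (ante c ⊢ Δ′) ∷ (Γ₂ ⊢ A ∷ Δ₂) ∷ H)
  after  : ∀ {G c H H′} → H ⇝ H′ → Located G c H (G ++ c ∷ H′)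

locate : ∀ G c H {T} → G ++ c ∷ H ⇝ T → Located G c H T
locate []          c H (⇝-here A p) = outof A p
locate []          c H (⇝-there m)  = after m
locate (_ ∷ [])    c H (⇝-here A p) = into [] A p
locate (_ ∷ _ ∷ _) c H (⇝-here A p) = before (⇝-here A p)
locate (e ∷ G)     c H (⇝-there m) with locate G c H m
... | before m′   = before (⇝-there m′)
... | into G₀ A p = into (e ∷ G₀) A p
... | outof A p   = outof A p
... | after m′    = after m′

Der-resp-≈ : ∀ {h S S′} → Der h S → S ≈ S′ → Der h S′
Der-resp-≈ (id₁ G H Γ Δ P ts eq) e = id₁ G H Γ Δ P ts (≈-trans (≈-sym e) eq)
Der-resp-≈ (id₂ G H F Γ₁ Δ₁ Γ₂ Δ₂ P ts eq) e = id₂ G H F Γ₁ Δ₁ Γ₂ Δ₂ P ts (≈-trans (≈-sym e) eq)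
Der-resp-≈ (⊥l G H Γ Δ eq) e = ⊥l G H Γ Δ (≈-trans (≈-sym e) eq)
Der-resp-≈ (∧l G H Γ Δ A B eq d) e = ∧l G H Γ Δ A B (≈-trans (≈-sym e) eq) d
Der-resp-≈ (∨r G H Γ Δ A B eq d) e = ∨r G H Γ Δ A B (≈-trans (≈-sym e) eq) d
Der-resp-≈ (∧r G H Γ Δ A B eq d d′) e = ∧r G H Γ Δ A B (≈-trans (≈-sym e) eq) d d′
Der-resp-≈ (∨l G H Γ Δ A B eq d d′) e = ∨l G H Γ Δ A B (≈-trans (≈-sym e) eq) d d′
Der-resp-≈ (⊃r₁ G Γ Δ A B eq d) e = ⊃r₁ G Γ Δ A B (≈-trans (≈-sym e) eq) d
Der-resp-≈ (⊃l G H Γ Δ A B eq d d′) e = ⊃l G H Γ Δ A B (≈-trans (≈-sym e) eq) d d′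
Der-resp-≈ (lift G H Γ₁ Δ₁ Γ₂ Δ₂ A eq d) e = lift G H Γ₁ Δ₁ Γ₂ Δ₂ A (≈-trans (≈-sym e) eq) d
Der-resp-≈ (∀l G H Γ Δ x A a eq d) e = ∀l G H Γ Δ x A a (≈-trans (≈-sym e) eq) d
Der-resp-≈ (∀r₁ G Γ Δ x A a eq n d) e = ∀r₁ G Γ Δ x A a (≈-trans (≈-sym e) eq) (∉parsS-resp-≈ e n) d
Der-resp-≈ (∃l G H Γ Δ x A a eq n d) e = ∃l G H Γ Δ x A a (≈-trans (≈-sym e) eq) (∉parsS-resp-≈ e n) d
Der-resp-≈ (∃r G H Γ Δ x A a eq d) e = ∃r G H Γ Δ x A a (≈-trans (≈-sym e) eq) d
Der-resp-≈ (⊃r₂ G H Γ₁ Δ₁ Γ₂ Δ₂ A B eq d d′) e = ⊃r₂ G H Γ₁ Δ₁ Γ₂ Δ₂ A B (≈-trans (≈-sym e) eq) d d′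
Der-resp-≈ (∀r₂ G H Γ₁ Δ₁ Γ₂ Δ₂ x A a eq n d d′) e =
  ∀r₂ G H Γ₁ Δ₁ Γ₂ Δ₂ x A a (≈-trans (≈-sym e) eq) (∉parsS-resp-≈ e n) d d′

Der-suc : ∀ {h S} → Der h S → Der (suc h) S
Der-suc (id₁ G H Γ Δ P ts eq) = id₁ G H Γ Δ P ts eq
Der-suc (id₂ G H F Γ₁ Δ₁ Γ₂ Δ₂ P ts eq) = id₂ G H F Γ₁ Δ₁ Γ₂ Δ₂ P ts eq
Der-suc (⊥l G H Γ Δ eq) = ⊥l G H Γ Δ eq
Der-suc (∧l G H Γ Δ A B eq d) = ∧l G H Γ Δ A B eq (Der-suc d)
Der-suc (∨r G H Γ Δ A B eq d) = ∨r G H Γ Δ A B eq (Der-suc d)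
Der-suc (∧r G H Γ Δ A B eq d d′) = ∧r G H Γ Δ A B eq (Der-suc d) (Der-suc d′)
Der-suc (∨l G H Γ Δ A B eq d d′) = ∨l G H Γ Δ A B eq (Der-suc d) (Der-suc d′)
Der-suc (⊃r₁ G Γ Δ A B eq d) = ⊃r₁ G Γ Δ A B eq (Der-suc d)
Der-suc (⊃l G H Γ Δ A B eq d d′) = ⊃l G H Γ Δ A B eq (Der-suc d) (Der-suc d′)
Der-suc (lift G H Γ₁ Δ₁ Γ₂ Δ₂ A eq d) = lift G H Γ₁ Δ₁ Γ₂ Δ₂ A eq (Der-suc d)
Der-suc (∀l G H Γ Δ x A a eq d) = ∀l G H Γ Δ x A a eq (Der-suc d)
Der-suc (∀r₁ G Γ Δ x A a eq n d) = ∀r₁ G Γ Δ x A a eq n (Der-suc d)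
Der-suc (∃l G H Γ Δ x A a eq n d) = ∃l G H Γ Δ x A a eq n (Der-suc d)
Der-suc (∃r G H Γ Δ x A a eq d) = ∃r G H Γ Δ x A a eq (Der-suc d)
Der-suc (⊃r₂ G H Γ₁ Δ₁ Γ₂ Δ₂ A B eq d d′) = ⊃r₂ G H Γ₁ Δ₁ Γ₂ Δ₂ A B eq (Der-suc d) (Der-suc d′)
Der-suc (∀r₂ G H Γ₁ Δ₁ Γ₂ Δ₂ x A a eq n d d′) = ∀r₂ G H Γ₁ Δ₁ Γ₂ Δ₂ x A a eq n (Der-suc d) (Der-suc d′)

via-≈ : ∀ {h S S′ T} → S ≈ S′ → S ⇝ T → (∀ {T′} → S′ ⇝ T′ → Der h T′) → Der h T
via-≈ S≈S′ m der with _ , m′ , T≈T′ ← ⇝-resp-≈ S≈S′ m = Der-resp-≈ (der m′) (≈-sym T≈T′)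

LwrAdmissible : ℕ → Set
LwrAdmissible h = ∀ {S T} → Der h S → S ⇝ T → Der h T

lwr-all : ∀ {h} → LwrAdmissible h → ∀ G Xs {Γ Δ Γ₂ Δ₂ H} →
          Der h (G ++ (Γ ⊢ Xs ++ Δ) ∷ (Γ₂ ⊢ Δ₂) ∷ H) → Der h ((G ++ [ Γ ⊢ Δ ]) ++ (Γ₂ ⊢ Xs ++ Δ₂) ∷ H)
lwr-all ih G []       d = Der-resp-≈ d (≈-assocʳ G ≈C-refl ≈C-refl)
lwr-all ih G (X ∷ Xs) d =
  Der-resp-≈ (lwr-all ih G Xs (ih d (⇝-at G X ↭-refl))) (≈-at (G ++ [ _ ]) (↭-refl , shift X Xs _))

OnRight : Formula → LNS → Set
OnRight A = Any (λ c → A ∈ succ c)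

data Initial (A : Formula) : LNS → Set where
  here  : ∀ {c S} → A ∈ ante c → OnRight A (c ∷ S) → Initial A (c ∷ S)
  there : ∀ {c S} → Initial A S → Initial A (c ∷ S)

Initial-++ˡ : ∀ {A} G {S} → Initial A S → Initial A (G ++ S)
Initial-++ˡ []      i = i
Initial-++ˡ (_ ∷ G) i = there (Initial-++ˡ G i)

Initial-id₁ : ∀ {P ts} G H Γ Δ → Initial (atom P ts) (G ++ (atom P ts ∷ Γ ⊢ atom P ts ∷ Δ) ∷ H)
Initial-id₁ G H Γ Δ = Initial-++ˡ G (here (here refl) (here (here refl)))

Initial-id₂ : ∀ {P ts} G H F Γ₁ Δ₁ Γ₂ Δ₂ →
              Initial (atom P ts) (G ++ (atom P ts ∷ Γ₁ ⊢ Δ₁) ∷ H ++ (Γ₂ ⊢ atom P ts ∷ Δ₂) ∷ F)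
Initial-id₂ G H F Γ₁ Δ₁ Γ₂ Δ₂ = Initial-++ˡ G (here (here refl) (there (Any.++⁺ʳ H (here (here refl)))))

Initial⇒Der : ∀ {h P ts} G {S} → Initial (atom P ts) S → Der (suc h) (G ++ S)
Initial⇒Der {P = P} {ts} G (here A∈Γ (here A∈Δ))
  with Γ , p ← ∈⇒↭ A∈Γ | Δ , q ← ∈⇒↭ A∈Δ = id₁ G _ Γ Δ P ts (≈-at G (p , q))
Initial⇒Der {P = P} {ts} G (here {c} A∈Γ₁ (there r))
  with Γ₁ , p ← ∈⇒↭ A∈Γ₁ | d , d∈S , A∈Δ₂ ← find r
  with M , F , refl ← ∈-∃++ d∈S | Δ₂ , q ← ∈⇒↭ A∈Δ₂ =
  id₂ G M F Γ₁ (succ c) (ante d) Δ₂ P ts (≈-++ˡ G ((p , ↭-refl) ∷ ≈-at M (↭-refl , q)))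
Initial⇒Der G (there {c} i) = subst (Der _) (++-assoc G [ c ] _) (Initial⇒Der (G ++ [ c ]) i)

OnRight-resp-≈ : ∀ {A S T} → S ≈ T → OnRight A S → OnRight A T
OnRight-resp-≈ = Pointwise.Any-resp-Pointwise (λ (_ , q) → ∈-resp-↭ q)

Initial-resp-≈ : ∀ {A S T} → S ≈ T → Initial A S → Initial A T
Initial-resp-≈ S≈T@((p , _) ∷ _) (here A∈ r) = here (∈-resp-↭ p A∈) (OnRight-resp-≈ S≈T r)
Initial-resp-≈ (_ ∷ S≈T)          (there i)   = there (Initial-resp-≈ S≈T i)

OnRight-resp-⇝ : ∀ {A S T} → S ⇝ T → OnRight A S → OnRight A T
OnRight-resp-⇝ (⇝-here B p) (here A∈Δ₁) with ∈-resp-↭ p A∈Δ₁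
... | here refl   = there (here (here refl))
... | there A∈Δ₁′ = here A∈Δ₁′
OnRight-resp-⇝ (⇝-here B p) (there (here A∈Δ₂)) = there (here (there A∈Δ₂))
OnRight-resp-⇝ (⇝-here B p) (there (there r))   = there (there r)
OnRight-resp-⇝ (⇝-there m)  (here A∈)           = here A∈
OnRight-resp-⇝ (⇝-there m)  (there r)           = there (OnRight-resp-⇝ m r)

Initial-resp-⇝ : ∀ {A S T} → S ⇝ T → Initial A S → Initial A T
Initial-resp-⇝ m@(⇝-here _ _) (here A∈ r) = here A∈ (OnRight-resp-⇝ m r)
Initial-resp-⇝ m@(⇝-there _)  (here A∈ r) = here A∈ (OnRight-resp-⇝ m r)
Initial-resp-⇝ (⇝-here B p) (there (here A∈ (here A∈Δ₂))) = there (here A∈ (here (there A∈Δ₂)))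
Initial-resp-⇝ (⇝-here B p) (there (here A∈ (there r)))   = there (here A∈ (there r))
Initial-resp-⇝ (⇝-here B p) (there (there i))             = there (there i)
Initial-resp-⇝ (⇝-there m)  (there i)                     = there (Initial-resp-⇝ m i)

lwr-initial : ∀ {h P ts S S′ T} → S ≈ S′ → Initial (atom P ts) S′ → S ⇝ T → Der (suc h) T
lwr-initial S≈S′ i m = Initial⇒Der [] (Initial-resp-⇝ m (Initial-resp-≈ (≈-sym S≈S′) i))

-- The conclusion's component is Γᵖ ++ Γ ⊢ Δᵖ ++ Δ; a premise (Γᵢ , Δᵢ) replaces it by Γᵢ ++ Γ ⊢ Δᵢ ++ Δ.
Premises : ℕ → List (List Formula × List Formula) → LNS → LNS → List Formula → List Formula → Set
Premises h ps G H Γ Δ = All (λ (Γᵢ , Δᵢ) → Der h (G ++ (Γᵢ ++ Γ ⊢ Δᵢ ++ Δ) ∷ H)) ps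

record LocalRule : Set₁ where
  field
    Γᵖ Δᵖ         : List Formula
    premises      : List (List Formula × List Formula)
    Side          : LNS → Set
    side-resp     : ∀ {S T} → SameFormulas S T → Side S → Side T
    infer         : ∀ {h S} G H Γ Δ → S ≈ (G ++ (Γᵖ ++ Γ ⊢ Δᵖ ++ Δ) ∷ H) → Side S →
                    Premises h premises G H Γ Δ → Der (suc h) S
    lwr-principal : ∀ {h} → LwrAdmissible h → ∀ {G Γ Δ Δ₁ A Γ₂ Δ₂ H} → A ∈ Δᵖ → Δᵖ ++ Δ ↭ A ∷ Δ₁ →
                    Premises h premises G ((Γ₂ ⊢ Δ₂) ∷ H) Γ Δ →
                    Der (suc h) (G ++ (Γᵖ ++ Γ ⊢ Δ₁) ∷ (Γ₂ ⊢ A ∷ Δ₂) ∷ H)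

leftRule : ∀ Γᵖ ps →
           (∀ {h S} G H Γ Δ → S ≈ (G ++ (Γᵖ ++ Γ ⊢ Δ) ∷ H) → Premises h ps G H Γ Δ → Der (suc h) S) →
           LocalRule
leftRule Γᵖ ps infer = record
  { Γᵖ = Γᵖ ; Δᵖ = [] ; premises = ps ; Side = const ⊤ ; side-resp = _
  ; infer = λ G H Γ Δ eq _ → infer G H Γ Δ eq
  ; lwr-principal = λ _ ()
  }

rightRule : ∀ Z Xss →
            (∀ {h S} G H Γ Δ → S ≈ (G ++ (Γ ⊢ Z ∷ Δ) ∷ H) → Premises h (map ([] ,_) Xss) G H Γ Δ →
             Der (suc h) S) →
            LocalRule
rightRule Z Xss infer = record
  { Γᵖ = [] ; Δᵖ = [ Z ] ; premises = map ([] ,_) Xss ; Side = const ⊤ ; side-resp = _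
  ; infer = λ G H Γ Δ eq _ → infer G H Γ Δ eq
  ; lwr-principal = λ { ih {G} (here refl) p ds →
      infer (G ++ [ _ ]) _ _ _ (≈-assocʳ G (↭-refl , ↭-sym (drop-∷ p)) ≈C-refl)
            (All.map⁺ (All.map (lwr-all ih G _) (All.map⁻ ds))) }
  }

⊥l-rule : LocalRule
⊥l-rule = leftRule [ ⊥' ] [] λ { G H Γ Δ eq [] → ⊥l G H Γ Δ eq }

∧l-rule : Formula → Formula → LocalRule
∧l-rule X Y = leftRule [ X ∧' Y ] ((X ∷ Y ∷ [] , []) ∷ [])
  λ { G H Γ Δ eq (d ∷ []) → ∧l G H Γ Δ X Y eq d }

∨l-rule : Formula → Formula → LocalRule
∨l-rule X Y = leftRule [ X ∨' Y ] (([ X ] , []) ∷ ([ Y ] , []) ∷ [])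
  λ { G H Γ Δ eq (d ∷ e ∷ []) → ∨l G H Γ Δ X Y eq d e }

⊃l-rule : Formula → Formula → LocalRule
⊃l-rule X Y = leftRule [ X ⊃ Y ] (([ Y ] , []) ∷ ([ X ⊃ Y ] , [ X ]) ∷ [])
  λ { G H Γ Δ eq (d ∷ e ∷ []) → ⊃l G H Γ Δ X Y eq d e }

∀l-rule : ℕ → Formula → ℕ → LocalRule
∀l-rule x X a = leftRule [ ∀' x X ] ((X [ a / x ] ∷ ∀' x X ∷ [] , []) ∷ [])
  λ { G H Γ Δ eq (d ∷ []) → ∀l G H Γ Δ x X a eq d }

∃l-rule : ℕ → Formula → ℕ → LocalRule
∃l-rule x X a = record
  { Γᵖ = [ ∃' x X ] ; Δᵖ = [] ; premises = ([ X [ a / x ] ] , []) ∷ []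
  ; Side = λ S → a ∉ parsS S ; side-resp = λ {S} {T} → ∉parsS-resp {S = S} {T}
  ; infer = λ { G H Γ Δ eq a∉S (d ∷ []) → ∃l G H Γ Δ x X a eq a∉S d }
  ; lwr-principal = λ _ ()
  }

∧r-rule : Formula → Formula → LocalRule
∧r-rule X Y = rightRule (X ∧' Y) ([ X ] ∷ [ Y ] ∷ [])
  λ { G H Γ Δ eq (d ∷ e ∷ []) → ∧r G H Γ Δ X Y eq d e }

∨r-rule : Formula → Formula → LocalRule
∨r-rule X Y = rightRule (X ∨' Y) ((X ∷ Y ∷ []) ∷ [])
  λ { G H Γ Δ eq (d ∷ []) → ∨r G H Γ Δ X Y eq d }

∃r-rule : ℕ → Formula → ℕ → LocalRule
∃r-rule x X a = rightRule (∃' x X) ((X [ a / x ] ∷ ∃' x X ∷ []) ∷ [])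
  λ { G H Γ Δ eq (d ∷ []) → ∃r G H Γ Δ x X a eq d }

module _ {h} (ih : LwrAdmissible h) (R : LocalRule) where
  open LocalRule R

  lwr-local : ∀ {G H Γ Δ T} → Premises h premises G H Γ Δ → Side T →
              Located G (Γᵖ ++ Γ ⊢ Δᵖ ++ Δ) H T → Der (suc h) T
  lwr-local ds s (before m) = infer _ _ _ _ ≈-refl s (All.map (λ d → ih d (⇝-++ʳ _ m)) ds)
  lwr-local {Γ = Γ} {Δ} ds s (into G₀ A p) =
    infer (G₀ ++ [ _ ]) _ Γ (A ∷ Δ) (≈-assocʳ G₀ ≈C-refl (↭-refl , ∷↭++∷ Δᵖ)) s
      (All.map (λ {(_ , Δᵢ)} d → Der-resp-≈ (ih d (⇝-at-snoc G₀ A p)) (≈-at (G₀ ++ [ _ ]) (↭-refl , ∷↭++∷ Δᵢ))) ds)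
  lwr-local {G} {Δ = Δ} ds s (outof A p) with ↭-∷-split Δᵖ Δ p
  ... | inj₁ A∈Δᵖ         = lwr-principal ih A∈Δᵖ p ds
  ... | inj₂ (Δ₀ , q , r) = infer G _ _ Δ₀ (≈-at G (↭-refl , r)) s
      (All.map (λ {(_ , Δᵢ)} d → ih d (⇝-at G A (↭-trans (++⁺ˡ Δᵢ q) (shift A Δᵢ Δ₀)))) ds)
  lwr-local {G} ds s (after m) = infer G _ _ _ ≈-refl s (All.map (λ d → ih d (⇝-++ˡ G (⇝-there m))) ds)

-- The principal formula of a component is analysed in a new component `nested`
-- inserted after it; in the second form it is also passed on to the next component.
record NestingRule : Set₁ where
  field
    principal : Formula
    nested    : Comp
    Side      : LNS → Set
    side-resp : ∀ {S T} → SameFormulas S T → Side S → Side T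
    infer₁    : ∀ {h S} G Γ Δ → S ≈ (G ++ [ Γ ⊢ principal ∷ Δ ]) → Side S →
                Der h (G ++ (Γ ⊢ Δ) ∷ [ nested ]) → Der (suc h) S
    infer₂    : ∀ {h S} G H Γ₁ Δ₁ Γ₂ Δ₂ → S ≈ (G ++ (Γ₁ ⊢ principal ∷ Δ₁) ∷ (Γ₂ ⊢ Δ₂) ∷ H) → Side S →
                Der h (G ++ (Γ₁ ⊢ Δ₁) ∷ nested ∷ (Γ₂ ⊢ Δ₂) ∷ H) →
                Der h (G ++ (Γ₁ ⊢ Δ₁) ∷ (Γ₂ ⊢ principal ∷ Δ₂) ∷ H) → Der (suc h) S

⊃r-rule : Formula → Formula → NestingRule
⊃r-rule X Y = record
  { principal = X ⊃ Y ; nested = [ X ] ⊢ [ Y ] ; Side = const ⊤ ; side-resp = _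
  ; infer₁ = λ G Γ Δ eq _ → ⊃r₁ G Γ Δ X Y eq
  ; infer₂ = λ G H Γ₁ Δ₁ Γ₂ Δ₂ eq _ → ⊃r₂ G H Γ₁ Δ₁ Γ₂ Δ₂ X Y eq
  }

∀r-rule : ℕ → Formula → ℕ → NestingRule
∀r-rule x X a = record
  { principal = ∀' x X ; nested = [] ⊢ [ X [ a / x ] ]
  ; Side = λ S → a ∉ parsS S ; side-resp = λ {S} {T} → ∉parsS-resp {S = S} {T}
  ; infer₁ = λ G Γ Δ eq a∉S → ∀r₁ G Γ Δ x X a eq a∉S
  ; infer₂ = λ G H Γ₁ Δ₁ Γ₂ Δ₂ eq a∉S → ∀r₂ G H Γ₁ Δ₁ Γ₂ Δ₂ x X a eq a∉S
  }

module _ {h} (ih : LwrAdmissible h) (R : NestingRule) where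
  open NestingRule R

  lwr-nesting₁ : ∀ {G Γ Δ T} → Der h (G ++ (Γ ⊢ Δ) ∷ [ nested ]) → Side T →
                 Located G (Γ ⊢ principal ∷ Δ) [] T → Der (suc h) T
  lwr-nesting₁ d s (before m) = infer₁ _ _ _ ≈-refl s (ih d (⇝-++ʳ _ m))
  lwr-nesting₁ {Γ = Γ} {Δ} d s (into G₀ A p) =
    infer₁ (G₀ ++ [ _ ]) Γ (A ∷ Δ) (≈-assocʳ G₀ ≈C-refl (↭-refl , ∷-swap)) s (ih d (⇝-at-snoc G₀ A p))
  lwr-nesting₁ d s (after ())

  lwr-nesting₂ : ∀ {G H Γ₁ Δ₁ Γ₂ Δ₂ T} →
                 Der h (G ++ (Γ₁ ⊢ Δ₁) ∷ nested ∷ (Γ₂ ⊢ Δ₂) ∷ H) →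
                 Der h (G ++ (Γ₁ ⊢ Δ₁) ∷ (Γ₂ ⊢ principal ∷ Δ₂) ∷ H) → Side T →
                 Located G (Γ₁ ⊢ principal ∷ Δ₁) ((Γ₂ ⊢ Δ₂) ∷ H) T → Der (suc h) T
  lwr-nesting₂ d e s (before m) = infer₂ _ _ _ _ _ _ ≈-refl s (ih d (⇝-++ʳ _ m)) (ih e (⇝-++ʳ _ m))
  lwr-nesting₂ {Γ₁ = Γ₁} {Δ₁} d e s (into G₀ A p) =
    infer₂ (G₀ ++ [ _ ]) _ Γ₁ (A ∷ Δ₁) _ _ (≈-assocʳ G₀ ≈C-refl (↭-refl , ∷-swap)) s
           (ih d (⇝-at-snoc G₀ A p)) (ih e (⇝-at-snoc G₀ A p))
  lwr-nesting₂ {G} {Δ₁ = Δ₁} d e s (outof A p) with ↭-∷-split [ principal ] Δ₁ p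
  ... | inj₁ (here refl)  = Der-suc (Der-resp-≈ e (≈-at G (↭-refl , drop-∷ p)))
  ... | inj₂ (Δ₀ , q , r) = infer₂ G _ _ Δ₀ _ _ (≈-at G (↭-refl , r)) s
          (ih (ih d (⇝-at G A q)) (⇝-++ˡ G (⇝-there (⇝-here A ↭-refl))))
          (Der-resp-≈ (ih e (⇝-at G A q)) (≈-++ˡ G (≈C-refl ∷ (↭-refl , ∷-swap) ∷ ≈-refl)))
  lwr-nesting₂ {G} d e s (after (⇝-here A p)) = infer₂ G _ _ _ _ _ ≈-refl s
    (ih d (⇝-++ˡ G (⇝-there (⇝-there (⇝-here A p)))))
    (ih e (⇝-++ˡ G (⇝-there (⇝-here A (↭-trans (↭-prep _ p) ∷-swap)))))
  lwr-nesting₂ {G} d e s (after (⇝-there m)) = infer₂ G _ _ _ _ _ ≈-refl s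
    (ih d (⇝-++ˡ G (⇝-there (⇝-there (⇝-there m))))) (ih e (⇝-++ˡ G (⇝-there (⇝-there m))))

module _ {h} (ih : LwrAdmissible h) where

  lwr-lift : ∀ {G H Γ₁ Δ₁ Γ₂ Δ₂ X T} → Der h (G ++ (X ∷ Γ₁ ⊢ Δ₁) ∷ (X ∷ Γ₂ ⊢ Δ₂) ∷ H) →
             Located G (X ∷ Γ₁ ⊢ Δ₁) ((Γ₂ ⊢ Δ₂) ∷ H) T → Der (suc h) T
  lwr-lift d (before m) = lift _ _ _ _ _ _ _ ≈-refl (ih d (⇝-++ʳ _ m))
  lwr-lift {Γ₁ = Γ₁} {Δ₁} d (into G₀ A p) =
    lift (G₀ ++ [ _ ]) _ Γ₁ (A ∷ Δ₁) _ _ _ (≈-assocʳ G₀ ≈C-refl ≈C-refl) (ih d (⇝-at-snoc G₀ A p))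
  lwr-lift {G} d (outof A p) = lift G _ _ _ _ _ _ ≈-refl (ih d (⇝-at G A p))
  lwr-lift {G} d (after (⇝-here A p)) = lift G _ _ _ _ _ _ ≈-refl (ih d (⇝-++ˡ G (⇝-there (⇝-here A p))))
  lwr-lift {G} d (after (⇝-there m)) = lift G _ _ _ _ _ _ ≈-refl (ih d (⇝-++ˡ G (⇝-there (⇝-there m))))

  lwr-suc : LwrAdmissible (suc h)
  lwr-suc (id₁ G H Γ Δ P ts eq) m = lwr-initial eq (Initial-id₁ G H Γ Δ) m
  lwr-suc (id₂ G H F Γ₁ Δ₁ Γ₂ Δ₂ P ts eq) m = lwr-initial eq (Initial-id₂ G H F Γ₁ Δ₁ Γ₂ Δ₂) m
  lwr-suc (⊥l G H Γ Δ eq) m = via-≈ eq m λ m′ → lwr-local ih ⊥l-rule {Γ = Γ} {Δ} [] tt (locate G _ H m′)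
  lwr-suc (∧l G H Γ Δ X Y eq d) m = via-≈ eq m λ m′ → lwr-local ih (∧l-rule X Y) (d ∷ []) tt (locate G _ H m′)
  lwr-suc (∨l G H Γ Δ X Y eq d e) m = via-≈ eq m λ m′ → lwr-local ih (∨l-rule X Y) (d ∷ e ∷ []) tt (locate G _ H m′)
  lwr-suc (⊃l G H Γ Δ X Y eq d e) m = via-≈ eq m λ m′ → lwr-local ih (⊃l-rule X Y) (d ∷ e ∷ []) tt (locate G _ H m′)
  lwr-suc (∀l G H Γ Δ x X a eq d) m = via-≈ eq m λ m′ → lwr-local ih (∀l-rule x X a) (d ∷ []) tt (locate G _ H m′)
  lwr-suc (∃l G H Γ Δ x X a eq a∉S d) m = via-≈ eq m λ m′ →
    lwr-local ih (∃l-rule x X a) (d ∷ []) (∉parsS-resp-⇝ m′ (∉parsS-resp-≈ eq a∉S)) (locate G _ H m′)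
  lwr-suc (∧r G H Γ Δ X Y eq d e) m = via-≈ eq m λ m′ → lwr-local ih (∧r-rule X Y) (d ∷ e ∷ []) tt (locate G _ H m′)
  lwr-suc (∨r G H Γ Δ X Y eq d) m = via-≈ eq m λ m′ → lwr-local ih (∨r-rule X Y) (d ∷ []) tt (locate G _ H m′)
  lwr-suc (∃r G H Γ Δ x X a eq d) m = via-≈ eq m λ m′ → lwr-local ih (∃r-rule x X a) (d ∷ []) tt (locate G _ H m′)
  lwr-suc (lift G H Γ₁ Δ₁ Γ₂ Δ₂ X eq d) m = via-≈ eq m λ m′ → lwr-lift d (locate G _ _ m′)
  lwr-suc (⊃r₁ G Γ Δ X Y eq d) m = via-≈ eq m λ m′ → lwr-nesting₁ ih (⊃r-rule X Y) d tt (locate G _ [] m′)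
  lwr-suc (∀r₁ G Γ Δ x X a eq a∉S d) m = via-≈ eq m λ m′ →
    lwr-nesting₁ ih (∀r-rule x X a) d (∉parsS-resp-⇝ m′ (∉parsS-resp-≈ eq a∉S)) (locate G _ [] m′)
  lwr-suc (⊃r₂ G H Γ₁ Δ₁ Γ₂ Δ₂ X Y eq d e) m = via-≈ eq m λ m′ →
    lwr-nesting₂ ih (⊃r-rule X Y) d e tt (locate G _ _ m′)
  lwr-suc (∀r₂ G H Γ₁ Δ₁ Γ₂ Δ₂ x X a eq a∉S d e) m = via-≈ eq m λ m′ →
    lwr-nesting₂ ih (∀r-rule x X a) d e (∉parsS-resp-⇝ m′ (∉parsS-resp-≈ eq a∉S)) (locate G _ _ m′)

lwr-admissible : ∀ h → LwrAdmissible h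
lwr-admissible zero    ()
lwr-admissible (suc h) = lwr-suc (lwr-admissible h)

lemma7 : (h : ℕ) (G H : List Comp) (Γ₁ Δ₁ Γ₂ Δ₂ : List Formula) (A : Formula) →
         Der h (G ++ (Γ₁ ⊢ A ∷ Δ₁) ∷ (Γ₂ ⊢ Δ₂) ∷ H) →
         Der h (G ++ (Γ₁ ⊢ Δ₁) ∷ (Γ₂ ⊢ A ∷ Δ₂) ∷ H)
lemma7 h G H Γ₁ Δ₁ Γ₂ Δ₂ A d = lwr-admissible h d (⇝-at G A ↭-refl)
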